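{- Let $\ell\ge 2$ and $n$ be integers and let $k=\ell-2$. Let $p=p_1\cdots p_\ell\in S_\ell$ and let $\pi=\pi_1\cdots\pi_n$ be a partial permutation with $k$ holes, whose set of hole positions is $H=\{h_1<\dots<h_k\}$. Let $I=[n]\setminus H$ and define $I_1=\{i\in I: i<h_1\}$, $I_{k+1}=\{i\in I: i>h_k\}$, and $I_a=\{i\in I: h_{a-1}<i<h_a\}$ for $2\le a\le k$ (if $k=0$, $I_1=I=[n]$). Then $\pi$ avoids $p$ if and only if for every two indices $i<j$ with $i\in I_a$ and $j\in I_b$, the relative order of $\pi_i$ and $\pi_j$ differs from that of $p_a$ and $p_{b+1}$ (i.e. $\pi_i<\pi_j\iff p_a>p_{b+1}$). Consequently, for each such $p$, $n$ and $H$, $s_n^H(p)\le 1$.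
   Context: A partial permutation of length $n$ with $k$ holes is a sequence $\pi_1\cdots\pi_n$ in which each of $1,\dots,n-k$ appears exactly once and the remaining $k$ entries are a hole symbol $\diamond$. A permutation $\sigma$ of $[n]$ is an extension of $\pi$ if the standardization (order-preserving relabeling by $1,2,\dots$) of $\sigma$ restricted to the non-hole positions equals $\pi$ restricted to them; $\pi$ avoids $p$ if every extension of $\pi$ avoids $p$ classically. $s_n^H(p)$ is the number of $p$-avoiding partial permutations of length $n$ whose holes are exactly at the positions in $H$. -}

module Defs where

open import Data.Nat using (ℕ; zero; suc; _+_; _∸_)
open import Data.Bool using (Bool; true; false; _∧_; if_then_else_)
open import Data.Fin using (Fin; zero; suc; toℕ; _<_; inject₁)
open import Data.Fin.Permutation using (Permutation′; _⟨$⟩ʳ_)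
open import Data.Maybe using (Maybe; just; nothing; is-just)
open import Data.Product using (Σ; ∃; _×_; _,_)
open import Relation.Nullary using (¬_; does)
open import Relation.Binary.PropositionalEquality using (_≡_)
open import Function.Bundles using (_⇔_)
import Data.Fin.Properties as FinP

count : ∀ {n} → (Fin n → Bool) → ℕ
count {zero} f = 0
count {suc n} f = (if f zero then 1 else 0) + count (λ x → f (suc x))

-- A partial permutation of length n with values in Fin m (m = n - #holes),
-- 0-indexed; 'nothing' is the hole symbol ◇.
PPerm : ℕ → ℕ → Set
PPerm n m = Fin n → Maybe (Fin m)

EachValueOnce : ∀ {n m} → PPerm n m → Set
EachValueOnce {n} {m} π =
  (∀ (v : Fin m) → ∃ λ (i : Fin n) → π i ≡ just v) ×
  (∀ (i j : Fin n) (v : Fin m) → π i ≡ just v → π j ≡ just v → i ≡ j)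

HolesExactly : ∀ {n m k} → PPerm n m → (Fin k → Fin n) → Set
HolesExactly {n} {m} {k} π h = ∀ (i : Fin n) → (π i ≡ nothing) ⇔ (∃ λ (c : Fin k) → h c ≡ i)

StrictlyIncreasing : ∀ {k n} → (Fin k → Fin n) → Set
StrictlyIncreasing h = ∀ c d → c < d → h c < h d

-- σ is an extension of π: the standardization of σ restricted to the
-- non-hole positions equals π there, i.e. for each non-hole position i,
-- π i (0-indexed) is the number of non-hole positions j with σ j < σ i.
IsExtension : ∀ {n m} → Permutation′ n → PPerm n m → Set
IsExtension {n} σ π =
  ∀ i v → π i ≡ just v →
    toℕ v ≡ count (λ j → is-just (π j) ∧ does (σ ⟨$⟩ʳ j FinP.<? σ ⟨$⟩ʳ i))

Contains : ∀ {n ℓ} → Permutation′ n → Permutation′ ℓ → Set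
Contains {n} {ℓ} σ p = Σ (Fin ℓ → Fin n) λ f →
  StrictlyIncreasing f ×
  (∀ a b → (σ ⟨$⟩ʳ f a < σ ⟨$⟩ʳ f b) ⇔ (p ⟨$⟩ʳ a < p ⟨$⟩ʳ b))

AvoidsPerm : ∀ {n ℓ} → Permutation′ n → Permutation′ ℓ → Set
AvoidsPerm σ p = ¬ Contains σ p

Avoids : ∀ {n m ℓ} → PPerm n m → Permutation′ ℓ → Set
Avoids {n} π p = ∀ (σ : Permutation′ n) → IsExtension σ π → AvoidsPerm σ p

-- A p-avoiding partial permutation of length n with holes exactly at H = im h
-- (k = |H| holes, values 0 .. n-k-1).  s_n^H(p) counts these.
record AvoidingPP (n k ℓ : ℕ) (h : Fin k → Fin n) (p : Permutation′ ℓ) : Set where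
  field
    perm    : PPerm n (n ∸ k)
    once    : EachValueOnce perm
    holes   : HolesExactly perm h
    avoids  : Avoids perm p

-- Block I_a (0-indexed a ∈ {0..k}, i.e. paper's I_{a+1}):
-- i ∉ H, and h_{a-1} < i (if a ≥ 1), and i < h_a (if a < k).
InBlock : ∀ {n k} → (Fin k → Fin n) → Fin (suc k) → Fin n → Set
InBlock {n} {k} h a i =
  (¬ ∃ λ (c : Fin k) → h c ≡ i) ×
  (∀ (c : Fin k) → suc (toℕ c) ≡ toℕ a → h c < i) ×
  (∀ (c : Fin k) → toℕ c ≡ toℕ a → i < h c)

-- Call the condition on π "block-reversed".  If it fails at nonholes i < j in blocks a ≤ b,
-- list i, j and all k holes increasingly: these k + 2 positions put i at index a and j at
-- index b + 1, and since π orders i, j as p orders a, b + 1, the holes can be filled so that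
-- an extension contains p there.  Conversely, along an occurrence of p in an extension let
-- B c count the holes before its c-th entry; B c − c starts ≥ 0 and ends < 0, so some nonhole
-- entry r lies in block r and a later one c in block c − 1, and block-reversal contradicts the
-- occurrence.  Finally, block-reversal fixes the relative order of any two nonholes, and the
-- value of a nonhole is the number of nonholes below it, so π is unique.
module Submission where

open import Defs
open import Data.Nat using (ℕ; suc; _∸_)
open import Data.Fin using (Fin; suc; _<_; inject₁)
open import Data.Fin.Permutation using (Permutation′; _⟨$⟩ʳ_)
open import Data.Maybe using (just)
open import Data.Product using (_×_)
open import Relation.Binary.PropositionalEquality using (_≡_)
open import Function.Bundles using (_⇔_)

open import Data.Bool using (Bool; true; false; _∧_; if_then_else_)
open import Data.Bool.Properties using (¬-not)
open import Data.Empty using (⊥)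
open import Data.Fin as Fin using (zero; toℕ; fromℕ<; _≤_; punchIn; punchOut)
import Data.Fin.Properties as Finₚ
open import Data.Fin.Induction using (>-weakInduction)
open import Data.Fin.Permutation using (permutation)
open import Data.Maybe using (Maybe; nothing; is-just; maybe)
open import Data.Maybe.Properties using (just-injective; ≡-dec)
open import Data.Nat as ℕ using (zero; _+_; _*_; z≤n; s≤s)
import Data.Nat.Properties as ℕₚ
open import Data.Product using (Σ; ∃; ∃₂; _,_; proj₁; proj₂)
open import Data.Sum using (_⊎_; inj₁; inj₂)
open import Data.Vec.Functional using (insertAt)
open import Data.Vec.Functional.Properties using (insertAt-lookup; insertAt-punchIn)
open import Function.Base using (_∘_)
open import Function.Bundles using (mk⇔; Equivalence; Injection)
open import Function.Construct.Composition using (_⇔-∘_)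
open import Function.Construct.Symmetry using (⇔-sym)
open import Function.Definitions using (Injective)
open import Function.Properties.Inverse using (↔⇒↣)
open import Relation.Binary.Definitions using (tri<; tri≈; tri>)
open import Relation.Binary.PropositionalEquality
  using (_≢_; refl; sym; trans; cong; cong₂; subst; subst₂; module ≡-Reasoning)
open import Relation.Nullary using (¬_; Dec; yes; no; does; contradiction)
open import Relation.Nullary.Decidable using (dec-true; dec-false; does-⇔)
open import Relation.Unary using (Decidable)

private
  variable
    k m n : ℕ

does⇒ : ∀ {A : Set} (a? : Dec A) → does a? ≡ true → A
does⇒ (yes a) _ = a
does⇒ (no _) ()

-- Counting

count≤n : (P : Fin n → Bool) → count P ℕ.≤ n
count≤n {zero} P = z≤n
count≤n {suc n} P with P zero
... | true  = s≤s (count≤n (P ∘ suc))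
... | false = ℕₚ.m≤n⇒m≤1+n (count≤n (P ∘ suc))

count<n : (P : Fin n → Bool) (x : Fin n) → P x ≡ false → count P ℕ.< n
count<n P zero Px rewrite Px = s≤s (count≤n (P ∘ suc))
count<n P (suc x) Px with P zero
... | true  = s≤s (count<n (P ∘ suc) x Px)
... | false = ℕₚ.m<n⇒m<1+n (count<n (P ∘ suc) x Px)

count-mono : {P Q : Fin n → Bool} → (∀ x → P x ≡ true → Q x ≡ true) → count P ℕ.≤ count Q
count-mono {zero} P⇒Q = z≤n
count-mono {suc n} {P} {Q} P⇒Q with P zero in P₀ | Q zero in Q₀
... | true  | true  = s≤s (count-mono (P⇒Q ∘ suc))
... | false | true  = ℕₚ.m≤n⇒m≤1+n (count-mono (P⇒Q ∘ suc))
... | false | false = count-mono (P⇒Q ∘ suc)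
... | true  | false = contradiction (trans (sym (P⇒Q zero P₀)) Q₀) λ ()

count-< : {P Q : Fin n → Bool} → (∀ x → P x ≡ true → Q x ≡ true) →
          ∀ x → P x ≡ false → Q x ≡ true → count P ℕ.< count Q
count-< {P = P} {Q} P⇒Q zero Px Qx rewrite Px | Qx = s≤s (count-mono (P⇒Q ∘ suc))
count-< {P = P} {Q} P⇒Q (suc x) Px Qx with P zero in P₀ | Q zero in Q₀
... | true  | true  = s≤s (count-< (P⇒Q ∘ suc) x Px Qx)
... | false | true  = ℕₚ.m<n⇒m<1+n (count-< (P⇒Q ∘ suc) x Px Qx)
... | false | false = count-< (P⇒Q ∘ suc) x Px Qx
... | true  | false = contradiction (trans (sym (P⇒Q zero P₀)) Q₀) λ ()

count-cong : {P Q : Fin n → Bool} → (∀ x → P x ≡ Q x) → count P ≡ count Q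
count-cong {zero} P≗Q = refl
count-cong {suc n} {P} {Q} P≗Q rewrite P≗Q zero = cong (_ +_) (count-cong (P≗Q ∘ suc))

count-false : (P : Fin n → Bool) → (∀ x → P x ≡ false) → count P ≡ 0
count-false {zero} P P≗false = refl
count-false {suc n} P P≗false rewrite P≗false zero = count-false (P ∘ suc) (P≗false ∘ suc)

count-suc : {P Q : Fin n → Bool} (x : Fin n) → (∀ y → y ≢ x → P y ≡ Q y) →
            P x ≡ false → Q x ≡ true → count Q ≡ suc (count P)
count-suc {P = P} {Q} zero P≗Q Px Qx rewrite Px | Qx =
  cong suc (count-cong λ y → sym (P≗Q (suc y) λ ()))
count-suc {P = P} {Q} (suc x) P≗Q Px Qx rewrite P≗Q zero (λ ()) =
  trans (cong (ind +_) (count-suc x (λ y y≢x → P≗Q (suc y) (y≢x ∘ Finₚ.suc-injective)) Px Qx))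
        (ℕₚ.+-suc ind (count (P ∘ suc)))
  where ind = if Q zero then 1 else 0

DownClosed : (Fin n → Bool) → Set
DownClosed P = ∀ {s t} → s < t → P t ≡ true → P s ≡ true

downClosed-count : {P : Fin n → Bool} → DownClosed P → ∀ t → P t ≡ true ⇔ toℕ t ℕ.< count P
downClosed-count {suc n} {P} P↓ t with P zero in P₀
downClosed-count {suc n} {P} P↓ zero    | true = mk⇔ (λ _ → s≤s z≤n) (λ _ → P₀)
downClosed-count {suc n} {P} P↓ (suc t) | true =
  let open Equivalence (downClosed-count (λ s<t → P↓ (s≤s s<t)) t)
  in mk⇔ (s≤s ∘ to) (from ∘ ℕₚ.≤-pred)
downClosed-count {suc n} {P} P↓ t | false =
  mk⇔ (λ Pt → contradiction Pt (never t))
      (λ t<0 → contradiction (subst (toℕ t ℕ.<_) empty t<0) ℕₚ.n≮0)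
  where
  never : ∀ t → P t ≢ true
  never zero    Pt = contradiction (trans (sym P₀) Pt) λ ()
  never (suc t) Pt = contradiction (trans (sym P₀) (P↓ (s≤s z≤n) Pt)) λ ()
  empty : count (P ∘ suc) ≡ 0
  empty = count-false (P ∘ suc) λ x → ¬-not (never (suc x))

valueBelow : ℕ → Maybe (Fin m) → Bool
valueBelow b (just w) = does (toℕ w ℕₚ.<? b)
valueBelow b nothing  = false

count-valueBelow : {π : PPerm n m} → EachValueOnce π → ∀ {b} → b ℕ.≤ m → count (valueBelow b ∘ π) ≡ b
count-valueBelow {π = π} once {zero} _ = count-false (valueBelow 0 ∘ π) none
  where
  none : ∀ x → valueBelow 0 (π x) ≡ false
  none x with π x
  ... | just w  = dec-false (toℕ w ℕₚ.<? 0) ℕₚ.n≮0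
  ... | nothing = refl
count-valueBelow {π = π} once@(onto , one-one) {suc b} b<m =
  trans (count-suc x₀ unchanged (step-false πx₀) (step-true πx₀))
        (cong suc (count-valueBelow once (ℕₚ.<⇒≤ b<m)))
  where
  w₀ = fromℕ< b<m
  x₀ = proj₁ (onto w₀)
  πx₀ = proj₂ (onto w₀)
  step-false : ∀ {mx} → mx ≡ just w₀ → valueBelow b mx ≡ false
  step-false refl = dec-false (toℕ w₀ ℕₚ.<? b) (ℕₚ.<-irrefl (Finₚ.toℕ-fromℕ< b<m))
  step-true : ∀ {mx} → mx ≡ just w₀ → valueBelow (suc b) mx ≡ true
  step-true refl = dec-true (toℕ w₀ ℕₚ.<? suc b) (ℕₚ.≤-reflexive (cong suc (Finₚ.toℕ-fromℕ< b<m)))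
  unchanged : ∀ y → y ≢ x₀ → valueBelow b (π y) ≡ valueBelow (suc b) (π y)
  unchanged y y≢x₀ with π y in πy
  ... | nothing = refl
  ... | just w = does-⇔ (mk⇔ ℕₚ.m<n⇒m<1+n (λ w<1+b → ℕₚ.≤∧≢⇒< (ℕₚ.≤-pred w<1+b) w≢b))
                        (toℕ w ℕₚ.<? b) (toℕ w ℕₚ.<? suc b)
    where
    w≢b : toℕ w ≢ b
    w≢b w≡b = y≢x₀ (one-one y x₀ w₀ (trans πy (cong just (Finₚ.toℕ-injective
                     (trans w≡b (sym (Finₚ.toℕ-fromℕ< b<m)))))) πx₀)

-- Permutations and extensions

injective⇒surjective : {f : Fin n → Fin n} → Injective _≡_ _≡_ f → ∀ y → ∃ λ x → f x ≡ y
injective⇒surjective {suc n} {f} f-inj y with Finₚ.any? (λ x → f x Finₚ.≟ y)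
... | yes hit = hit
... | no miss = contradiction (Finₚ.injective⇒≤ squeezed-inj) ℕₚ.1+n≰n
  where
  y≢f : ∀ x → y ≢ f x
  y≢f x y≡fx = miss (x , sym y≡fx)
  squeezed : Fin (suc n) → Fin n
  squeezed x = punchOut (y≢f x)
  squeezed-inj : Injective _≡_ _≡_ squeezed
  squeezed-inj = f-inj ∘ Finₚ.punchOut-injective (y≢f _) (y≢f _)

injective⇒permutation : (f : Fin n → Fin n) → Injective _≡_ _≡_ f →
                        Σ (Permutation′ n) λ σ → ∀ x → σ ⟨$⟩ʳ x ≡ f x
injective⇒permutation f f-inj =
  permutation f (proj₁ ∘ onto) (proj₂ ∘ onto) (λ x → f-inj (proj₂ (onto (f x)))) , λ _ → refl
  where onto = injective⇒surjective f-inj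

lex-< : ∀ {a b r s} n → r ℕ.< n → a ℕ.< b → a * n + r ℕ.< b * n + s
lex-< {a} {b} {r} {s} n r<n a<b = begin-strict
  a * n + r  <⟨ ℕₚ.+-monoʳ-< (a * n) r<n ⟩
  a * n + n  ≡⟨ ℕₚ.+-comm (a * n) n ⟩
  suc a * n  ≤⟨ ℕₚ.*-monoˡ-≤ n a<b ⟩
  b * n      ≤⟨ ℕₚ.m≤m+n (b * n) s ⟩
  b * n + s  ∎
  where open ℕₚ.≤-Reasoning

ranking-permutation : (key : Fin n → ℕ) → Injective _≡_ _≡_ key →
  Σ (Permutation′ n) λ σ → ∀ x y → key x ℕ.< key y → σ ⟨$⟩ʳ x < σ ⟨$⟩ʳ y
ranking-permutation {n} key key-injective =
  σ , λ x y kx<ky → subst₂ ℕ._<_ (sym (σ-rank x)) (sym (σ-rank y)) (rank-< kx<ky)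
  where
  rank : Fin n → ℕ
  rank x = count (λ y → does (key y ℕₚ.<? key x))

  rank-< : ∀ {x y} → key x ℕ.< key y → rank x ℕ.< rank y
  rank-< {x} {y} x<y = count-<
    (λ z z<x → dec-true (key z ℕₚ.<? key y) (ℕₚ.<-trans (does⇒ (key z ℕₚ.<? key x) z<x) x<y))
    x (dec-false (key x ℕₚ.<? key x) (ℕₚ.<-irrefl refl)) (dec-true (key x ℕₚ.<? key y) x<y)

  rank<n : ∀ x → rank x ℕ.< n
  rank<n x = count<n _ x (dec-false (key x ℕₚ.<? key x) (ℕₚ.<-irrefl refl))

  rankFin : Fin n → Fin n
  rankFin x = fromℕ< (rank<n x)

  rankFin-injective : Injective _≡_ _≡_ rankFin
  rankFin-injective {x} {y} eq with ℕₚ.<-cmp (key x) (key y)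
  ... | tri< x<y _ _ = contradiction ranks≡ (ℕₚ.<⇒≢ (rank-< x<y))
    where ranks≡ = Finₚ.fromℕ<-injective _ _ (rank<n x) (rank<n y) eq
  ... | tri≈ _ x≡y _ = key-injective x≡y
  ... | tri> _ _ y<x = contradiction (sym ranks≡) (ℕₚ.<⇒≢ (rank-< y<x))
    where ranks≡ = Finₚ.fromℕ<-injective _ _ (rank<n x) (rank<n y) eq

  σ : Permutation′ n
  σ = proj₁ (injective⇒permutation rankFin rankFin-injective)

  σ-rank : ∀ x → toℕ (σ ⟨$⟩ʳ x) ≡ rank x
  σ-rank x = trans (cong toℕ (proj₂ (injective⇒permutation rankFin rankFin-injective) x))
                   (Finₚ.toℕ-fromℕ< (rank<n x))

sorting-permutation : (key : Fin n → ℕ) →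
  Σ (Permutation′ n) λ σ → ∀ x y → key x ℕ.< key y → σ ⟨$⟩ʳ x < σ ⟨$⟩ʳ y
sorting-permutation {n} key =
  let σ , ranked = ranking-permutation key′ key′-injective
  in  σ , λ x y kx<ky → ranked x y (lex-< n (Finₚ.toℕ<n x) kx<ky)
  where
  -- ties are broken by position
  key′ : Fin n → ℕ
  key′ x = key x * n + toℕ x

  key′-injective : Injective _≡_ _≡_ key′
  key′-injective {x} {y} eq with ℕₚ.<-cmp (key x) (key y)
  ... | tri< kx<ky _ _ = contradiction eq (ℕₚ.<⇒≢ (lex-< n (Finₚ.toℕ<n x) kx<ky))
  ... | tri≈ _ kx≡ky _ = Finₚ.toℕ-injective (ℕₚ.+-cancelˡ-≡ (key x * n) _ _
                           (trans eq (cong (λ z → z * n + toℕ y) (sym kx≡ky))))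
  ... | tri> _ _ ky<kx = contradiction (sym eq) (ℕₚ.<⇒≢ (lex-< n (Finₚ.toℕ<n y) ky<kx))

⟨$⟩ʳ-injective : (σ : Permutation′ n) → Injective _≡_ _≡_ (σ ⟨$⟩ʳ_)
⟨$⟩ʳ-injective σ = Injection.injective (↔⇒↣ σ)

<⇔<-by-cases : {a b : Fin n} {u v : Fin m} →
               (u < v → a < b) → (v < u → b < a) → (u ≡ v → a ≡ b) → a < b ⇔ u < v
<⇔<-by-cases {u = u} {v} u<v⇒ v<u⇒ u≡v⇒ = mk⇔ from-a<b u<v⇒
  where
  from-a<b : _ → u < v
  from-a<b a<b with Finₚ.<-cmp u v
  ... | tri< u<v _ _ = u<v
  ... | tri≈ _ u≡v _ = contradiction (u≡v⇒ u≡v) (Finₚ.<⇒≢ a<b)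
  ... | tri> _ _ v<u = contradiction (v<u⇒ v<u) (ℕₚ.<-asym a<b)

module _ {π : PPerm n m} {σ : Permutation′ n} where

  NonholesOrderedBy : Set
  NonholesOrderedBy = ∀ {x y u v} → π x ≡ just u → π y ≡ just v → σ ⟨$⟩ʳ x < σ ⟨$⟩ʳ y ⇔ u < v

  extension⇒ordered : IsExtension σ π → NonholesOrderedBy
  extension⇒ordered ext {x} {y} {u} {v} πx πy = ⇔-sym (<⇔<-by-cases (σ-mono πx πy) (σ-mono πy πx)
    λ σx≡σy → just-injective (trans (sym πx) (trans (cong π (⟨$⟩ʳ-injective σ σx≡σy)) πy)))
    where
    smaller : Fin n → Fin n → Bool
    smaller x j = is-just (π j) ∧ does (σ ⟨$⟩ʳ j Finₚ.<? σ ⟨$⟩ʳ x)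
    smaller-⊆ : ∀ {x y} → σ ⟨$⟩ʳ x < σ ⟨$⟩ʳ y → ∀ j → smaller x j ≡ true → smaller y j ≡ true
    smaller-⊆ {x} {y} σx<σy j with π j
    ... | just _ = λ σj<σx → dec-true (σ ⟨$⟩ʳ j Finₚ.<? σ ⟨$⟩ʳ y)
                               (ℕₚ.<-trans (does⇒ (σ ⟨$⟩ʳ j Finₚ.<? σ ⟨$⟩ʳ x) σj<σx) σx<σy)
    ... | nothing = λ ()
    σ-mono : ∀ {x y u v} → π x ≡ just u → π y ≡ just v → σ ⟨$⟩ʳ x < σ ⟨$⟩ʳ y → u < v
    σ-mono {x} {y} {u} {v} πx πy σx<σy = subst₂ ℕ._<_ (sym (ext x u πx)) (sym (ext y v πy))
      (count-< (smaller-⊆ σx<σy) x not-self self)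
      where
      not-self : smaller x x ≡ false
      not-self rewrite πx = dec-false (σ ⟨$⟩ʳ x Finₚ.<? σ ⟨$⟩ʳ x) (ℕₚ.<-irrefl refl)
      self : smaller y x ≡ true
      self rewrite πx = dec-true (σ ⟨$⟩ʳ x Finₚ.<? σ ⟨$⟩ʳ y) σx<σy

  ordered⇒extension : EachValueOnce π → NonholesOrderedBy → IsExtension σ π
  ordered⇒extension once ordered x v πx =
    sym (trans (count-cong same) (count-valueBelow once (ℕₚ.<⇒≤ (Finₚ.toℕ<n v))))
    where
    same : ∀ j → (is-just (π j) ∧ does (σ ⟨$⟩ʳ j Finₚ.<? σ ⟨$⟩ʳ x)) ≡ valueBelow (toℕ v) (π j)
    same j with π j in πj
    ... | just w  = does-⇔ (ordered πj πx) (σ ⟨$⟩ʳ j Finₚ.<? σ ⟨$⟩ʳ x) (toℕ w ℕₚ.<? toℕ v)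
    ... | nothing = refl

-- Blocks and insertion into increasing sequences

increasing⇒monotone : {g : Fin k → Fin n} → StrictlyIncreasing g → ∀ {t t′} → t ≤ t′ → g t ≤ g t′
increasing⇒monotone {g = g} g-inc {t} {t′} t≤t′ with Finₚ.<-cmp t t′
... | tri< t<t′ _ _ = ℕₚ.<⇒≤ (g-inc t t′ t<t′)
... | tri≈ _ refl _ = ℕₚ.≤-refl
... | tri> _ _ t′<t = contradiction t≤t′ (ℕₚ.<⇒≱ t′<t)

increasing⇒injective : {g : Fin k → Fin n} → StrictlyIncreasing g → Injective _≡_ _≡_ g
increasing⇒injective {g = g} g-inc {t} {t′} gt≡gt′ with Finₚ.<-cmp t t′
... | tri< t<t′ _ _ = contradiction gt≡gt′ (Finₚ.<⇒≢ (g-inc t t′ t<t′))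
... | tri≈ _ t≡t′ _ = t≡t′
... | tri> _ _ t′<t = contradiction (sym gt≡gt′) (Finₚ.<⇒≢ (g-inc t′ t t′<t))

-- InBlock, stated against all indices of g instead of the two neighbouring ones.
Gap : (Fin k → Fin n) → Fin (suc k) → Fin n → Set
Gap g s x = (∀ t → toℕ t ℕ.< toℕ s → g t < x) × (∀ t → toℕ s ℕ.≤ toℕ t → x < g t)

gap⇒inBlock : {g : Fin k → Fin n} {s : Fin (suc k)} {x : Fin n} → Gap g s x → InBlock g s x
gap⇒inBlock {g = g} {s} {x} (below , above) =
  not-hit , (λ c 1+c≡s → below c (ℕₚ.≤-reflexive 1+c≡s)) , (λ c c≡s → above c (ℕₚ.≤-reflexive (sym c≡s)))
  where
  not-hit : ¬ ∃ λ c → g c ≡ x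
  not-hit (c , refl) with toℕ c ℕₚ.<? toℕ s
  ... | yes c<s = Finₚ.<-irrefl refl (below c c<s)
  ... | no  c≮s = Finₚ.<-irrefl refl (above c (ℕₚ.≮⇒≥ c≮s))

inBlock⇒gap : {g : Fin k → Fin n} {s : Fin (suc k)} {x : Fin n} →
              StrictlyIncreasing g → InBlock g s x → Gap g s x
inBlock⇒gap {k = k} {g = g} {s} {x} g-inc (_ , left , right) = below s left , above
  where
  below : ∀ s → (∀ c → suc (toℕ c) ≡ toℕ s → g c < x) → ∀ t → toℕ t ℕ.< toℕ s → g t < x
  below (suc s′) left t (s≤s t≤s′) = ℕₚ.≤-<-trans (increasing⇒monotone g-inc t≤s′) (left s′ refl)
  above : ∀ t → toℕ s ℕ.≤ toℕ t → x < g t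
  above t s≤t = ℕₚ.<-≤-trans (right s′ (Finₚ.toℕ-fromℕ< s<k)) (increasing⇒monotone g-inc s′≤t)
    where
    s<k : toℕ s ℕ.< k
    s<k = ℕₚ.≤-<-trans s≤t (Finₚ.toℕ<n t)
    s′ = fromℕ< s<k
    s′≤t : s′ ≤ t
    s′≤t = subst (ℕ._≤ toℕ t) (sym (Finₚ.toℕ-fromℕ< s<k)) s≤t

gap-≤ : {g : Fin k → Fin n} {s s′ : Fin (suc k)} {x y : Fin n} →
        Gap g s x → Gap g s′ y → x < y → toℕ s ℕ.≤ toℕ s′
gap-≤ {k = k} {s = s} {s′} (x-below , _) (_ , y-above) x<y with toℕ s ℕₚ.≤? toℕ s′
... | yes s≤s′ = s≤s′
... | no  s≰s′ = contradiction (Finₚ.<-trans x<y (y-above t s′≤t)) (Finₚ.<-asym (x-below t t<s))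
  where
  s′<s = ℕₚ.≰⇒> s≰s′
  s′<k : toℕ s′ ℕ.< k
  s′<k = ℕₚ.<-≤-trans s′<s (ℕₚ.≤-pred (Finₚ.toℕ<n s))
  t = fromℕ< s′<k
  t<s : toℕ t ℕ.< toℕ s
  t<s = subst (ℕ._< toℕ s) (sym (Finₚ.toℕ-fromℕ< s′<k)) s′<s
  s′≤t : toℕ s′ ℕ.≤ toℕ t
  s′≤t = ℕₚ.≤-reflexive (sym (Finₚ.toℕ-fromℕ< s′<k))

module _ (h : Fin k → Fin n) where

  holesBefore : Fin n → ℕ
  holesBefore x = count (λ t → does (h t Finₚ.<? x))

  holesBefore-≤ : ∀ x → holesBefore x ℕ.≤ k
  holesBefore-≤ x = count≤n _

  holesBefore-mono : ∀ {x y} → x ≤ y → holesBefore x ℕ.≤ holesBefore y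
  holesBefore-mono {x} {y} x≤y = count-mono λ t ht<x →
    dec-true (h t Finₚ.<? y) (ℕₚ.<-≤-trans (does⇒ (h t Finₚ.<? x) ht<x) x≤y)

  holesBefore-hole : ∀ t → holesBefore (h t) ℕ.< k
  holesBefore-hole t = count<n _ t (dec-false (h t Finₚ.<? h t) (Finₚ.<-irrefl refl))

  holesBefore-after-hole : ∀ {t y} → h t < y → holesBefore (h t) ℕ.< holesBefore y
  holesBefore-after-hole {t} {y} ht<y = count-<
    (λ s hs<ht → dec-true (h s Finₚ.<? y) (Finₚ.<-trans (does⇒ (h s Finₚ.<? h t) hs<ht) ht<y))
    t (dec-false (h t Finₚ.<? h t) (Finₚ.<-irrefl refl)) (dec-true (h t Finₚ.<? y) ht<y)

  slot : Fin n → Fin (suc k)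
  slot x = fromℕ< (s≤s (holesBefore-≤ x))

  gap-slot : StrictlyIncreasing h → ∀ {x} → ¬ (∃ λ c → h c ≡ x) → Gap h (slot x) x
  gap-slot h-inc {x} not-hit = below , above
    where
    hole<x⇔ : ∀ t → h t < x ⇔ toℕ t ℕ.< holesBefore x
    hole<x⇔ t = downClosed-count (λ {s} {t} s<t ht<x →
                   dec-true (h s Finₚ.<? x) (Finₚ.<-trans (h-inc s t s<t) (does⇒ (h t Finₚ.<? x) ht<x))) t
                ⇔-∘ mk⇔ (dec-true (h t Finₚ.<? x)) (does⇒ (h t Finₚ.<? x))
    slot≡ : toℕ (slot x) ≡ holesBefore x
    slot≡ = Finₚ.toℕ-fromℕ< (s≤s (holesBefore-≤ x))
    below : ∀ t → toℕ t ℕ.< toℕ (slot x) → h t < x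
    below t t<s = Equivalence.from (hole<x⇔ t) (subst (toℕ t ℕ.<_) slot≡ t<s)
    above : ∀ t → toℕ (slot x) ℕ.≤ toℕ t → x < h t
    above t s≤t = Finₚ.≤∧≢⇒< (ℕₚ.≮⇒≥ λ ht<x → ℕₚ.<⇒≱ (Equivalence.to (hole<x⇔ t) ht<x)
                                                  (subst (ℕ._≤ toℕ t) slot≡ s≤t))
                             (λ x≡ht → not-hit (t , sym x≡ht))

toℕ-punchIn-< : {s : Fin (suc k)} {t : Fin k} → toℕ t ℕ.< toℕ s → toℕ (punchIn s t) ≡ toℕ t
toℕ-punchIn-< {s = suc s} {zero}  _           = refl
toℕ-punchIn-< {s = suc s} {suc t} (s≤s t<s) = cong suc (toℕ-punchIn-< t<s)

toℕ-punchIn-≥ : {s : Fin (suc k)} {t : Fin k} → toℕ s ℕ.≤ toℕ t → toℕ (punchIn s t) ≡ suc (toℕ t)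
toℕ-punchIn-≥ {s = zero}  {t}     _         = refl
toℕ-punchIn-≥ {s = suc s} {suc t} (s≤s s≤t) = cong suc (toℕ-punchIn-≥ s≤t)

data PunchView (s : Fin (suc k)) : Fin (suc k) → Set where
  at     : PunchView s s
  beside : ∀ t → PunchView s (punchIn s t)

punchView : ∀ (s c : Fin (suc k)) → PunchView s c
punchView s c with s Finₚ.≟ c
... | yes refl = at
... | no  s≢c  = subst (PunchView s) (Finₚ.punchIn-punchOut s≢c) (beside (punchOut s≢c))

punchIn<⇔ : {s : Fin (suc k)} {t : Fin k} → punchIn s t < s ⇔ toℕ t ℕ.< toℕ s
punchIn<⇔ {s = s} {t} = mk⇔ to λ t<s → subst (ℕ._< toℕ s) (sym (toℕ-punchIn-< t<s)) t<s
  where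
  to : punchIn s t < s → toℕ t ℕ.< toℕ s
  to p<s = ℕₚ.≰⇒> λ s≤t → ℕₚ.<-asym p<s (subst (toℕ s ℕ.<_) (sym (toℕ-punchIn-≥ s≤t)) (s≤s s≤t))

punchIn-cancel-< : ∀ (s : Fin (suc k)) {t t′} → punchIn s t < punchIn s t′ → t < t′
punchIn-cancel-< s {t} {t′} p<p′ =
  Finₚ.≤∧≢⇒< (Finₚ.punchIn-cancel-≤ s t t′ (ℕₚ.<⇒≤ p<p′)) λ { refl → Finₚ.<-irrefl refl p<p′ }

insertAt-increasing : {g : Fin k → Fin n} {s : Fin (suc k)} {x : Fin n} →
                      StrictlyIncreasing g → Gap g s x → StrictlyIncreasing (insertAt g s x)
insertAt-increasing {g = g} {s} {x} g-inc (below , above) c d c<d with punchView s c | punchView s d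
... | at       | at        = contradiction c<d (Finₚ.<-irrefl refl)
... | at       | beside t  = subst₂ _<_ (sym (insertAt-lookup g s x)) (sym (insertAt-punchIn g s x t))
                               (above t (ℕₚ.≮⇒≥ λ t<s → ℕₚ.<-asym c<d (Equivalence.from punchIn<⇔ t<s)))
... | beside t | at        = subst₂ _<_ (sym (insertAt-punchIn g s x t)) (sym (insertAt-lookup g s x))
                               (below t (Equivalence.to punchIn<⇔ c<d))
... | beside t | beside t′ = subst₂ _<_ (sym (insertAt-punchIn g s x t)) (sym (insertAt-punchIn g s x t′))
                               (g-inc t t′ (punchIn-cancel-< s c<d))

gap-insertAt : {g : Fin k → Fin n} {s s′ : Fin (suc k)} {x y : Fin n} →
               Gap g s x → Gap g s′ y → x < y → Gap (insertAt g s x) (suc s′) y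
gap-insertAt {g = g} {s} {s′} {x} {y} x∈s y∈s′@(y-below , y-above) x<y = below , above
  where
  s≤s′ = gap-≤ x∈s y∈s′ x<y
  below : ∀ t → toℕ t ℕ.< suc (toℕ s′) → insertAt g s x t < y
  below t t≤s′ with punchView s t
  ... | at = subst (_< y) (sym (insertAt-lookup g s x)) x<y
  ... | beside t₀ = subst (_< y) (sym (insertAt-punchIn g s x t₀)) (y-below t₀ t₀<s′)
    where
    t₀<s′ : toℕ t₀ ℕ.< toℕ s′
    t₀<s′ with toℕ t₀ ℕₚ.<? toℕ s
    ... | yes t₀<s = ℕₚ.<-≤-trans t₀<s s≤s′
    ... | no  t₀≮s = subst (ℕ._≤ toℕ s′) (toℕ-punchIn-≥ (ℕₚ.≮⇒≥ t₀≮s)) (ℕₚ.≤-pred t≤s′)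
  above : ∀ t → suc (toℕ s′) ℕ.≤ toℕ t → y < insertAt g s x t
  above t s′<t with punchView s t
  ... | at = contradiction s≤s′ (ℕₚ.<⇒≱ s′<t)
  ... | beside t₀ = subst (y <_) (sym (insertAt-punchIn g s x t₀)) (y-above t₀ s′≤t₀)
    where
    s′≤t₀ : toℕ s′ ℕ.≤ toℕ t₀
    s′≤t₀ with toℕ t₀ ℕₚ.<? toℕ s
    ... | yes t₀<s = contradiction (ℕₚ.<-≤-trans t₀<s s≤s′)
                       (ℕₚ.≤⇒≯ (ℕₚ.≤-trans (ℕₚ.n≤1+n _) (subst (suc (toℕ s′) ℕ.≤_) (toℕ-punchIn-< t₀<s) s′<t)))
    ... | no  t₀≮s = ℕₚ.≤-pred (subst (suc (toℕ s′) ℕ.≤_) (toℕ-punchIn-≥ (ℕₚ.≮⇒≥ t₀≮s)) s′<t)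

record Occurrence (h : Fin k → Fin n) (a b : Fin (suc k)) (i j : Fin n) : Set where
  field
    pos            : Fin (suc (suc k)) → Fin n
    pos-increasing : StrictlyIncreasing pos
    pos-a          : pos (inject₁ a) ≡ i
    pos-b          : pos (suc b) ≡ j
    pos-hole       : ∀ c → c ≢ inject₁ a → c ≢ suc b → ∃ λ t → h t ≡ pos c

occurrence : {h : Fin k → Fin n} → StrictlyIncreasing h → ∀ {a b : Fin (suc k)} {i j : Fin n} →
             i < j → Gap h a i → Gap h b j → Occurrence h a b i j
occurrence {h = h} h-inc {a} {b} {i} {j} i<j i∈a j∈b = record
  { pos            = f
  ; pos-increasing = insertAt-increasing (insertAt-increasing h-inc i∈a) (gap-insertAt i∈a j∈b i<j)
  ; pos-a          = f-a
  ; pos-b          = insertAt-lookup h′ (suc b) j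
  ; pos-hole       = f-hole
  }
  where
  h′ = insertAt h a i
  f = insertAt h′ (suc b) j
  a≡ : punchIn (suc b) a ≡ inject₁ a
  a≡ = Finₚ.toℕ-injective (trans (toℕ-punchIn-< (s≤s (gap-≤ i∈a j∈b i<j))) (sym (Finₚ.toℕ-inject₁ a)))
  f-a : f (inject₁ a) ≡ i
  f-a = begin
    f (inject₁ a)          ≡⟨ cong f a≡ ⟨
    f (punchIn (suc b) a)  ≡⟨ insertAt-punchIn h′ (suc b) j a ⟩
    h′ a                   ≡⟨ insertAt-lookup h a i ⟩
    i                      ∎
    where open ≡-Reasoning
  f-hole : ∀ c → c ≢ inject₁ a → c ≢ suc b → ∃ λ t → h t ≡ f c
  f-hole c c≢a c≢b with punchView (suc b) c
  ... | at = contradiction refl c≢b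
  ... | beside t with punchView a t
  ...   | at = contradiction a≡ c≢a
  ...   | beside t₀ = t₀ , sym (trans (insertAt-punchIn h′ (suc b) j (punchIn a t₀)) (insertAt-punchIn h a i t₀))

-- Filling the holes of an occurrence

-- σ sorts positions by (value, letter) lexicographically.  A nonhole keeps its π-value; a hole
-- with p-letter P borrows the value of the first of the two nonholes whose letter is ≥ P (or
-- one more than the larger value), so it lands just below that nonhole.  Along f both
-- components then grow with the letter.
module _ {K : ℕ} (p : Permutation′ K) {f : Fin K → Fin n} (f-inc : StrictlyIncreasing f)
         {π : PPerm n m} (once : EachValueOnce π) {c₁ c₂ : Fin K} {w₁ w₂ : Fin m}
         (πfc₁ : π (f c₁) ≡ just w₁) (πfc₂ : π (f c₂) ≡ just w₂)
         (w₁<w₂ : w₁ < w₂) (pc₁<pc₂ : p ⟨$⟩ʳ c₁ < p ⟨$⟩ʳ c₂)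
         (holes : ∀ c → c ≢ c₁ → c ≢ c₂ → π (f c) ≡ nothing) where

  private
    X₁ X₂ x₁ x₂ : ℕ
    X₁ = toℕ (p ⟨$⟩ʳ c₁)
    X₂ = toℕ (p ⟨$⟩ʳ c₂)
    x₁ = toℕ w₁
    x₂ = toℕ w₂

    layer : ℕ → ℕ
    layer P with P ℕₚ.≤? X₁ | P ℕₚ.≤? X₂
    ... | yes _ | _     = x₁
    ... | no _  | yes _ = x₂
    ... | no _  | no _  = suc x₂

    layer-≤X₁ : ∀ {P} → P ℕ.≤ X₁ → layer P ≡ x₁
    layer-≤X₁ {P} P≤X₁ with P ℕₚ.≤? X₁
    ... | yes _   = refl
    ... | no  P≰X₁ = contradiction P≤X₁ P≰X₁

    layer-≤X₂ : ∀ {P} → P ℕ.≤ X₂ → layer P ℕ.≤ x₂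
    layer-≤X₂ {P} P≤X₂ with P ℕₚ.≤? X₁ | P ℕₚ.≤? X₂
    ... | yes _ | _      = ℕₚ.<⇒≤ w₁<w₂
    ... | no _  | yes _  = ℕₚ.≤-refl
    ... | no _  | no P≰X₂ = contradiction P≤X₂ P≰X₂

    layer-≤ : ∀ P → layer P ℕ.≤ suc x₂
    layer-≤ P with P ℕₚ.≤? X₁ | P ℕₚ.≤? X₂
    ... | yes _ | _     = ℕₚ.m≤n⇒m≤1+n (ℕₚ.<⇒≤ w₁<w₂)
    ... | no _  | yes _ = ℕₚ.n≤1+n x₂
    ... | no _  | no _  = ℕₚ.≤-refl

    layer-mono : ∀ {P Q} → P ℕ.≤ Q → layer P ℕ.≤ layer Q
    layer-mono {P} {Q} P≤Q with Q ℕₚ.≤? X₁ | Q ℕₚ.≤? X₂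
    ... | yes Q≤X₁ | _     = ℕₚ.≤-reflexive (layer-≤X₁ (ℕₚ.≤-trans P≤Q Q≤X₁))
    ... | no _     | yes Q≤X₂ = layer-≤X₂ (ℕₚ.≤-trans P≤Q Q≤X₂)
    ... | no _     | no _  = layer-≤ P

    layer-X₂ : layer X₂ ≡ x₂
    layer-X₂ with X₂ ℕₚ.≤? X₁ | X₂ ℕₚ.≤? X₂
    ... | yes X₂≤X₁ | _     = contradiction X₂≤X₁ (ℕₚ.<⇒≱ pc₁<pc₂)
    ... | no _      | yes _ = refl
    ... | no _      | no X₂≰X₂ = contradiction ℕₚ.≤-refl X₂≰X₂

    letter : Fin n → ℕ
    letter x with Finₚ.any? (λ c → f c Finₚ.≟ x)
    ... | yes (c , _) = toℕ (p ⟨$⟩ʳ c)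
    ... | no _        = 0

    letter-f : ∀ c → letter (f c) ≡ toℕ (p ⟨$⟩ʳ c)
    letter-f c with Finₚ.any? (λ d → f d Finₚ.≟ f c)
    ... | yes (d , fd≡fc) = cong (λ e → toℕ (p ⟨$⟩ʳ e)) (increasing⇒injective f-inc fd≡fc)
    ... | no  miss        = contradiction (c , refl) miss

    letter<K : ∀ x → letter x ℕ.< K
    letter<K x with Finₚ.any? (λ c → f c Finₚ.≟ x)
    ... | yes (c , _) = Finₚ.toℕ<n (p ⟨$⟩ʳ c)
    ... | no _        = ℕₚ.≤-<-trans z≤n (Finₚ.toℕ<n c₁)

    value : Fin n → ℕ
    value x = maybe toℕ (layer (letter x)) (π x)

    key : Fin n → ℕ
    key x = value x * K + letter x

    value-f : ∀ c → value (f c) ≡ layer (toℕ (p ⟨$⟩ʳ c))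
    value-f c with c Finₚ.≟ c₁ | c Finₚ.≟ c₂
    ... | yes refl | _ = trans (cong (maybe toℕ _) πfc₁) (sym (layer-≤X₁ ℕₚ.≤-refl))
    ... | no _ | yes refl = trans (cong (maybe toℕ _) πfc₂) (sym layer-X₂)
    ... | no c≢c₁ | no c≢c₂ = trans (cong (maybe toℕ _) (holes c c≢c₁ c≢c₂)) (cong layer (letter-f c))

    key-f-< : ∀ {c d} → p ⟨$⟩ʳ c < p ⟨$⟩ʳ d → key (f c) ℕ.< key (f d)
    key-f-< {c} {d} pc<pd = begin-strict
      value (f c) * K + letter (f c)              ≡⟨ cong₂ (λ v l → v * K + l) (value-f c) (letter-f c) ⟩
      layer (toℕ (p ⟨$⟩ʳ c)) * K + toℕ (p ⟨$⟩ʳ c) <⟨ ℕₚ.+-mono-≤-< (ℕₚ.*-monoˡ-≤ K (layer-mono (ℕₚ.<⇒≤ pc<pd))) pc<pd ⟩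
      layer (toℕ (p ⟨$⟩ʳ d)) * K + toℕ (p ⟨$⟩ʳ d) ≡⟨ cong₂ (λ v l → v * K + l) (value-f d) (letter-f d) ⟨
      value (f d) * K + letter (f d)              ∎
      where open ℕₚ.≤-Reasoning

    key-nonhole-< : ∀ {x y u v} → π x ≡ just u → π y ≡ just v → u < v → key x ℕ.< key y
    key-nonhole-< {x} {y} πx πy u<v rewrite πx | πy = lex-< K (letter<K x) u<v

    σ : Permutation′ n
    σ = proj₁ (sorting-permutation key)

    σ-sorts : ∀ {x y} → key x ℕ.< key y → σ ⟨$⟩ʳ x < σ ⟨$⟩ʳ y
    σ-sorts = proj₂ (sorting-permutation key) _ _

    ordered : NonholesOrderedBy {π = π} {σ}
    ordered πx πy = <⇔<-by-cases (σ-sorts ∘ key-nonhole-< πx πy) (σ-sorts ∘ key-nonhole-< πy πx)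
      λ { refl → cong (σ ⟨$⟩ʳ_) (proj₂ once _ _ _ πx πy) }

  extension-containing : ∃ λ σ → IsExtension σ π × Contains σ p
  extension-containing = σ , ordered⇒extension {σ = σ} once ordered , f , f-inc ,
    λ c d → <⇔<-by-cases (σ-sorts ∘ key-f-<) (σ-sorts ∘ key-f-<)
              λ pc≡pd → cong (λ e → σ ⟨$⟩ʳ f e) (⟨$⟩ʳ-injective p pc≡pd)

-- The crossing argument

-- Read B c − c along the k + 2 positions: it starts ≥ 0, ends < 0 (a hole keeps B c below k),
-- never decreases across a hole and drops by at most one across a nonhole.  So somewhere it
-- steps from 0 at a nonhole r to −1 at the next nonhole c.
module _ {k : ℕ} {Hole : Fin (suc (suc k)) → Set} (hole? : Decidable Hole) {B : Fin (suc (suc k)) → ℕ}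
         (B-mono : ∀ c → B (inject₁ c) ℕ.≤ B (suc c))
         (B-hole : ∀ c → Hole (inject₁ c) → B (inject₁ c) ℕ.< B (suc c))
         (B-≤ : ∀ c → B c ℕ.≤ k) (B-hole-< : ∀ c → Hole c → B c ℕ.< k) where

  Crossing : Set
  Crossing = ∃₂ λ r c → r < c × ¬ Hole r × ¬ Hole c × B r ≡ toℕ r × suc (B c) ≡ toℕ c

  private
    Started : Fin (suc (suc k)) → Set
    Started c = ∃ λ r → r < c × ¬ Hole r × B r ≡ toℕ r

    Invariant : Fin (suc (suc k)) → Set
    Invariant c = toℕ c ℕ.≤ B c ⊎ (Started c × toℕ c ℕ.≤ suc (B c))

    last : Fin (suc (suc k))
    last = Fin.fromℕ (suc k)

    toℕ-last : toℕ last ≡ suc k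
    toℕ-last = Finₚ.toℕ-fromℕ (suc k)

    at-end : Invariant last → Crossing
    at-end (inj₁ last≤B) = contradiction (B-≤ last) (ℕₚ.<⇒≱ (subst (ℕ._≤ B last) toℕ-last last≤B))
    at-end (inj₂ ((r , r<last , r-nonhole , Br≡r) , last≤1+B)) = finish (hole? last)
      where
      k≤B : k ℕ.≤ B last
      k≤B = ℕₚ.≤-pred (subst (ℕ._≤ suc (B last)) toℕ-last last≤1+B)
      finish : Dec (Hole last) → Crossing
      finish (yes hole)    = contradiction k≤B (ℕₚ.<⇒≱ (B-hole-< last hole))
      finish (no  nonhole) = r , last , r<last , r-nonhole , nonhole , Br≡r ,
                             trans (cong suc (ℕₚ.≤-antisym (B-≤ last) k≤B)) (sym toℕ-last)

    c<1+c : ∀ {c : Fin (suc k)} → inject₁ c < suc c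
    c<1+c = Finₚ.≤̄⇒inject₁< Finₚ.≤-refl

    ↓ : ∀ {c : Fin (suc k)} {b} → toℕ (inject₁ c) ℕ.≤ b → toℕ c ℕ.≤ b
    ↓ {c} = subst (ℕ._≤ _) (Finₚ.toℕ-inject₁ c)

    step : ∀ c → (Invariant (suc c) → Crossing) → Invariant (inject₁ c) → Crossing
    step c next inv with hole? (inject₁ c) | inv
    ... | yes hole | inj₁ c≤B = next (inj₁ (ℕₚ.≤-<-trans (↓ c≤B) (B-hole c hole)))
    ... | yes hole | inj₂ ((r , r<c , rest) , c≤1+B) =
      next (inj₂ ((r , Finₚ.<-trans r<c c<1+c , rest) , s≤s (↓ (ℕₚ.≤-trans c≤1+B (B-hole c hole)))))
    ... | no nonhole | inj₁ c≤B with B (inject₁ c) ℕₚ.≟ toℕ (inject₁ c)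
    ...   | yes B≡c = next (inj₂ ((inject₁ c , c<1+c , nonhole , B≡c) ,
                                  s≤s (↓ (ℕₚ.≤-trans (ℕₚ.≤-reflexive (sym B≡c)) (B-mono c)))))
    ...   | no  B≢c = next (inj₁ (ℕₚ.≤-<-trans (↓ ℕₚ.≤-refl) (ℕₚ.<-≤-trans (ℕₚ.≤∧≢⇒< c≤B (B≢c ∘ sym)) (B-mono c))))
    step c next inv | no nonhole | inj₂ ((r , r<c , rest) , c≤1+B) with suc (B (inject₁ c)) ℕₚ.≟ toℕ (inject₁ c)
    ...   | yes 1+B≡c = r , inject₁ c , r<c , proj₁ rest , nonhole , proj₂ rest , 1+B≡c
    ...   | no  1+B≢c = next (inj₂ ((r , Finₚ.<-trans r<c c<1+c , rest) ,
                                  s≤s (↓ (ℕₚ.≤-trans (ℕₚ.≤-pred (ℕₚ.≤∧≢⇒< c≤1+B (1+B≢c ∘ sym))) (B-mono c)))))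

  crossing : Crossing
  crossing = >-weakInduction (λ c → Invariant c → Crossing) at-end step zero (inj₁ z≤n)

-- Block-reversed partial permutations

BlockReversed : Permutation′ (suc (suc k)) → (Fin k → Fin n) → PPerm n m → Set
BlockReversed {k} {n} {m} p h π = ∀ (a b : Fin (suc k)) (i j : Fin n) (u v : Fin m) →
  i < j → InBlock h a i → InBlock h b j → π i ≡ just u → π j ≡ just v →
  (u < v) ⇔ (p ⟨$⟩ʳ suc b < p ⟨$⟩ʳ inject₁ a)

≢nothing⇒just : ∀ {A : Set} {mx : Maybe A} → mx ≢ nothing → ∃ λ a → mx ≡ just a
≢nothing⇒just {mx = just a}  _ = a , refl
≢nothing⇒just {mx = nothing} mx≢nothing = contradiction refl mx≢nothing

<⇔>-irrefl : {x y : Fin n} → x ≢ y → ¬ (x < y ⇔ y < x)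
<⇔>-irrefl {x = x} {y} x≢y x<y⇔y<x with Finₚ.<-cmp x y
... | tri< x<y _ _ = Finₚ.<-asym x<y (Equivalence.to x<y⇔y<x x<y)
... | tri≈ _ x≡y _ = x≢y x≡y
... | tri> _ _ y<x = Finₚ.<-asym y<x (Equivalence.from x<y⇔y<x y<x)

exclusive⇒reversed : {u v : Fin m} {X Y : Fin n} → u ≢ v → X ≢ Y →
                      ¬ (u < v × X < Y) → ¬ (v < u × Y < X) → u < v ⇔ Y < X
exclusive⇒reversed {u = u} {v} {X} {Y} u≢v X≢Y ¬up ¬down = mk⇔ to from
  where
  to : u < v → Y < X
  to u<v with Finₚ.<-cmp X Y
  ... | tri< X<Y _ _ = contradiction (u<v , X<Y) ¬up
  ... | tri≈ _ X≡Y _ = contradiction X≡Y X≢Y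
  ... | tri> _ _ Y<X = Y<X
  from : Y < X → u < v
  from Y<X with Finₚ.<-cmp u v
  ... | tri< u<v _ _ = u<v
  ... | tri≈ _ u≡v _ = contradiction u≡v u≢v
  ... | tri> _ _ v<u = contradiction (v<u , Y<X) ¬down

module _ {h : Fin k → Fin n} (h-inc : StrictlyIncreasing h) {π : PPerm n m} (holes : HolesExactly π h) where

  nonhole-inBlock : ∀ {x u} → π x ≡ just u → InBlock h (slot h x) x
  nonhole-inBlock {x} πx = gap⇒inBlock (gap-slot h h-inc λ hit →
    contradiction (trans (sym πx) (Equivalence.from (holes x) hit)) λ ())

  block-crossing : {f : Fin (suc (suc k)) → Fin n} → StrictlyIncreasing f →
    ∃₂ λ r c → r < c × inject₁ (slot h (f r)) ≡ r × suc (slot h (f c)) ≡ c ×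
               (∃ λ u → π (f r) ≡ just u) × (∃ λ v → π (f c) ≡ just v)
  block-crossing {f} f-inc with crossing hole? B-mono B-hole B-≤ B-hole<
    where
    Hole : Fin (suc (suc k)) → Set
    Hole c = π (f c) ≡ nothing
    hole? : Decidable Hole
    hole? c = ≡-dec Finₚ._≟_ (π (f c)) nothing
    B : Fin (suc (suc k)) → ℕ
    B c = holesBefore h (f c)
    f-step : ∀ c → f (inject₁ c) < f (suc c)
    f-step c = f-inc _ _ (Finₚ.≤̄⇒inject₁< Finₚ.≤-refl)
    B-mono : ∀ c → B (inject₁ c) ℕ.≤ B (suc c)
    B-mono c = holesBefore-mono h (ℕₚ.<⇒≤ (f-step c))
    B-hole : ∀ c → Hole (inject₁ c) → B (inject₁ c) ℕ.< B (suc c)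
    B-hole c hole with t , ht≡ ← Equivalence.to (holes (f (inject₁ c))) hole =
      subst (λ y → holesBefore h y ℕ.< B (suc c)) ht≡
            (holesBefore-after-hole h (subst (_< f (suc c)) (sym ht≡) (f-step c)))
    B-≤ : ∀ c → B c ℕ.≤ k
    B-≤ c = holesBefore-≤ h (f c)
    B-hole< : ∀ c → Hole c → B c ℕ.< k
    B-hole< c hole with t , ht≡ ← Equivalence.to (holes (f c)) hole =
      subst (λ y → holesBefore h y ℕ.< k) ht≡ (holesBefore-hole h t)
  ... | r , c , r<c , r-nonhole , c-nonhole , Br≡r , 1+Bc≡c =
    r , c , r<c ,
    Finₚ.toℕ-injective (trans (Finₚ.toℕ-inject₁ _) (trans (Finₚ.toℕ-fromℕ< _) Br≡r)) ,
    Finₚ.toℕ-injective (trans (cong suc (Finₚ.toℕ-fromℕ< _)) 1+Bc≡c) ,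
    ≢nothing⇒just r-nonhole , ≢nothing⇒just c-nonhole

  reversed⇒avoids : ∀ {p} → BlockReversed p h π → Avoids π p
  reversed⇒avoids {p} reversed σ ext (f , f-inc , f-iso)
    with r , c , r<c , a≡r , b≡c , (u , πfr) , (v , πfc) ← block-crossing f-inc =
    <⇔>-irrefl (λ pr≡pc → Finₚ.<-irrefl (⟨$⟩ʳ-injective p pr≡pc) r<c)
      (subst₂ (λ c′ r′ → u < v ⇔ p ⟨$⟩ʳ c′ < p ⟨$⟩ʳ r′) b≡c a≡r
         (reversed _ _ _ _ u v (f-inc r c r<c) (nonhole-inBlock πfr) (nonhole-inBlock πfc) πfr πfc)
       ⇔-∘ (extension⇒ordered {σ = σ} ext πfr πfc ⇔-∘ ⇔-sym (f-iso r c)))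

  avoids⇒reversed : ∀ {p} → EachValueOnce π → Avoids π p → BlockReversed p h π
  avoids⇒reversed {p} once avoids a b i j u v i<j i∈a j∈b πi πj =
    exclusive⇒reversed u≢v (λ pa≡pb → a≢b (⟨$⟩ʳ-injective p pa≡pb))
      (λ (u<v , pa<pb) → no-occurrence πfa πfb u<v pa<pb holes-f)
      (λ (v<u , pb<pa) → no-occurrence πfb πfa v<u pb<pa λ c c≢b c≢a → holes-f c c≢a c≢b)
    where
    i∈a′ = inBlock⇒gap h-inc i∈a
    j∈b′ = inBlock⇒gap h-inc j∈b
    open Occurrence (occurrence h-inc i<j i∈a′ j∈b′)
    πfa : π (pos (inject₁ a)) ≡ just u
    πfa = trans (cong π pos-a) πi
    πfb : π (pos (suc b)) ≡ just v
    πfb = trans (cong π pos-b) πj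
    holes-f : ∀ c → c ≢ inject₁ a → c ≢ suc b → π (pos c) ≡ nothing
    holes-f c c≢a c≢b = Equivalence.from (holes (pos c)) (pos-hole c c≢a c≢b)
    no-occurrence : ∀ {c₁ c₂ w₁ w₂} → π (pos c₁) ≡ just w₁ → π (pos c₂) ≡ just w₂ → w₁ < w₂ →
                    p ⟨$⟩ʳ c₁ < p ⟨$⟩ʳ c₂ → (∀ c → c ≢ c₁ → c ≢ c₂ → π (pos c) ≡ nothing) → ⊥
    no-occurrence πfc₁ πfc₂ w₁<w₂ pc₁<pc₂ rest =
      let σ , ext , contains = extension-containing p pos-increasing once πfc₁ πfc₂ w₁<w₂ pc₁<pc₂ rest
      in avoids σ ext contains
    u≢v : u ≢ v
    u≢v refl = Finₚ.<-irrefl (proj₂ once i j u πi πj) i<j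
    a≢b : inject₁ a ≢ suc b
    a≢b a≡b = ℕₚ.<-irrefl (trans (sym (Finₚ.toℕ-inject₁ a)) (cong toℕ a≡b)) (s≤s (gap-≤ i∈a′ j∈b′ i<j))

<⇔<-flip : {u v : Fin m} {u′ v′ : Fin n} → u ≢ v → u′ ≢ v′ → u < v ⇔ u′ < v′ → v < u ⇔ v′ < u′
<⇔<-flip {u = u} {v} {u′} {v′} u≢v u′≢v′ same = mk⇔ to from
  where
  to : v < u → v′ < u′
  to v<u with Finₚ.<-cmp u′ v′
  ... | tri< u′<v′ _ _ = contradiction (Equivalence.from same u′<v′) (Finₚ.<-asym v<u)
  ... | tri≈ _ u′≡v′ _ = contradiction u′≡v′ u′≢v′
  ... | tri> _ _ v′<u′ = v′<u′
  from : v′ < u′ → v < u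
  from v′<u′ with Finₚ.<-cmp u v
  ... | tri< u<v _ _ = contradiction (Equivalence.to same u<v) (Finₚ.<-asym v′<u′)
  ... | tri≈ _ u≡v _ = contradiction u≡v u≢v
  ... | tri> _ _ v<u = v<u

distinct-values : {π : PPerm n m} → EachValueOnce π → ∀ {x y u v} → x ≢ y → π x ≡ just u → π y ≡ just v → u ≢ v
distinct-values once x≢y πx πy refl = x≢y (proj₂ once _ _ _ πx πy)

module _ {p : Permutation′ (suc (suc k))} {h : Fin k → Fin n} (h-inc : StrictlyIncreasing h)
         {π π′ : PPerm n m} (once : EachValueOnce π) (once′ : EachValueOnce π′)
         (holes : HolesExactly π h) (holes′ : HolesExactly π′ h)
         (reversed : BlockReversed p h π) (reversed′ : BlockReversed p h π′) where

  private
    same-hole : ∀ y → π y ≡ nothing ⇔ π′ y ≡ nothing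
    same-hole y = ⇔-sym (holes′ y) ⇔-∘ holes y

    same-order : ∀ {y z v w v′ w′} → y < z → π y ≡ just v → π z ≡ just w →
                 π′ y ≡ just v′ → π′ z ≡ just w′ → v < w ⇔ v′ < w′
    same-order y<z πy πz π′y π′z = ⇔-sym (reversed′ _ _ _ _ _ _ y<z y∈ z∈ π′y π′z)
                                   ⇔-∘ reversed _ _ _ _ _ _ y<z y∈ z∈ πy πz
      where
      y∈ = nonhole-inBlock h-inc holes πy
      z∈ = nonhole-inBlock h-inc holes πz

    below-agree : ∀ {x u u′} → π x ≡ just u → π′ x ≡ just u′ → ∀ y →
                  valueBelow (toℕ u) (π y) ≡ valueBelow (toℕ u′) (π′ y)
    below-agree {x} {u} {u′} πx π′x y with π y in πy | π′ y in π′y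
    ... | nothing | nothing = refl
    ... | nothing | just _  = contradiction (trans (sym π′y) (Equivalence.to (same-hole y) πy)) λ ()
    ... | just _  | nothing = contradiction (trans (sym πy) (Equivalence.from (same-hole y) π′y)) λ ()
    ... | just v  | just v′ = does-⇔ order (toℕ v ℕₚ.<? toℕ u) (toℕ v′ ℕₚ.<? toℕ u′)
      where
      order : v < u ⇔ v′ < u′
      order with Finₚ.<-cmp x y
      ... | tri< x<y x≢y _ = <⇔<-flip (distinct-values once x≢y πx πy) (distinct-values once′ x≢y π′x π′y)
                                       (same-order x<y πx πy π′x π′y)
      ... | tri≈ _ refl _ = mk⇔ (λ v<u → contradiction (just-injective (trans (sym πy) πx)) (Finₚ.<⇒≢ v<u))
                                (λ v′<u′ → contradiction (just-injective (trans (sym π′y) π′x)) (Finₚ.<⇒≢ v′<u′))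
      ... | tri> _ _ y<x = same-order y<x πy πx π′y π′x

  reversed-unique : ∀ x → π x ≡ π′ x
  reversed-unique x with π x in πx | π′ x in π′x
  ... | nothing | nothing = refl
  ... | nothing | just _  = contradiction (trans (sym π′x) (Equivalence.to (same-hole x) πx)) λ ()
  ... | just _  | nothing = contradiction (trans (sym πx) (Equivalence.from (same-hole x) π′x)) λ ()
  ... | just u  | just u′ = cong just (Finₚ.toℕ-injective (begin
    toℕ u                             ≡⟨ count-valueBelow once (ℕₚ.<⇒≤ (Finₚ.toℕ<n u)) ⟨
    count (valueBelow (toℕ u) ∘ π)    ≡⟨ count-cong (below-agree πx π′x) ⟩
    count (valueBelow (toℕ u′) ∘ π′)  ≡⟨ count-valueBelow once′ (ℕₚ.<⇒≤ (Finₚ.toℕ<n u′)) ⟩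
    toℕ u′                            ∎))
    where open ≡-Reasoning

lemma23 : ∀ (k n : ℕ) (p : Permutation′ (suc (suc k))) (h : Fin k → Fin n) →
    StrictlyIncreasing h →
    (∀ (π : PPerm n (n ∸ k)) → EachValueOnce π → HolesExactly π h →
      Avoids π p ⇔
        (∀ (a b : Fin (suc k)) (i j : Fin n) (u v : Fin (n ∸ k)) →
          i < j → InBlock h a i → InBlock h b j → π i ≡ just u → π j ≡ just v →
          (u < v) ⇔ (p ⟨$⟩ʳ suc b < p ⟨$⟩ʳ inject₁ a)))
    × (∀ (x y : AvoidingPP n k (suc (suc k)) h p) →
        ∀ i → AvoidingPP.perm x i ≡ AvoidingPP.perm y i)
lemma23 k n p h h-inc = characterisation , uniqueness
  where
  characterisation : ∀ π → EachValueOnce π → HolesExactly π h → Avoids π p ⇔ BlockReversed p h π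
  characterisation π once holes = mk⇔ (avoids⇒reversed h-inc holes {p} once) (reversed⇒avoids h-inc holes {p})
  uniqueness : ∀ (x y : AvoidingPP n k (suc (suc k)) h p) → ∀ i → AvoidingPP.perm x i ≡ AvoidingPP.perm y i
  uniqueness x y = reversed-unique {p = p} h-inc (once x) (once y) (holes x) (holes y)
    (avoids⇒reversed h-inc (holes x) {p} (once x) (avoids x)) (avoids⇒reversed h-inc (holes y) {p} (once y) (avoids y))
    where open AvoidingPP
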